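{- Let $a'$ and $b$ be integers with $a',b\ge 2$. If there exists an integer $\kappa$ with $$\mathrm{b}(a',b)\le\kappa\le\lceil\log_b(b^\kappa-a'b)\rceil,$$ then $\mathrm{b}(b^{\kappa-1}-a',b)=\kappa$.
   Context: For positive integers $a,b$, $\mathrm{b}(a,b)$ denotes the base size (smallest cardinality of a subset whose pointwise stabilizer is trivial) of $\mathrm{Sym}(ab)$ acting on the set of partitions of $\{1,\ldots,ab\}$ into $b$ parts each of cardinality $a$. -}

module Defs where

open import Data.Nat using (ℕ; _+_; _*_; _^_; _≤_; _<_)
open import Data.Fin using (Fin; _≟_)
open import Data.Fin.Permutation using (Permutation′; _⟨$⟩ʳ_)
open import Data.List using (List; length; filter; allFin)
open import Data.List.Relation.Unary.All using (All)
open import Data.Product using (Σ; _×_; ∃-syntax)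
open import Function.Bundles using (_⇔_)
open import Relation.Binary.PropositionalEquality using (_≡_)
open import Relation.Nullary using (¬_)

-- A partition of Ω = Fin (a * b) into b parts each of cardinality a,
-- given by a labelling of points by parts (labels matter only up to
-- relabelling: see `Fixes`, which only uses "same part" information).
record Part (a b : ℕ) : Set where
  field
    lab  : Fin (a * b) → Fin b
    size : ∀ (k : Fin b) → length (filter (λ i → lab i ≟ k) (allFin (a * b))) ≡ a
open Part public

Fixes : ∀ {a b} → Permutation′ (a * b) → Part a b → Set
Fixes σ P = ∀ i j → (lab P i ≡ lab P j) ⇔ (lab P (σ ⟨$⟩ʳ i) ≡ lab P (σ ⟨$⟩ʳ j))

IsBase : ∀ a b → List (Part a b) → Set
IsBase a b S = ∀ (σ : Permutation′ (a * b)) → All (Fixes σ) S → ∀ i → σ ⟨$⟩ʳ i ≡ i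

HasBaseOfSize : ℕ → ℕ → ℕ → Set
HasBaseOfSize a b k = Σ (List (Part a b)) λ S → length S ≡ k × IsBase a b S

BaseSizeIs : ℕ → ℕ → ℕ → Set
BaseSizeIs a b k = HasBaseOfSize a b k × (∀ m → m < k → ¬ HasBaseOfSize a b m)

BaseSizeAtMost : ℕ → ℕ → ℕ → Set
BaseSizeAtMost a b k = ∃[ m ] (m ≤ k × HasBaseOfSize a b m)

IsCeilLog : ℕ → ℕ → ℕ → Set
IsCeilLog b y l = y ≤ b ^ l × (∀ j → j < l → b ^ j < y)

{-# OPTIONS --safe #-}
-- Recording, for each point of Fin (a′b), its part in each member of a base of size κ
-- (padded to exactly κ members) gives an injective signature into the words of length κ
-- over Fin b, whose i-th letter takes every value exactly a′ times. The b^κ − a′b words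
-- outside the image therefore take every value b^(κ−1) − a′ = a times in each coordinate,
-- so reading their coordinates gives κ partitions of a set of size ab. A permutation
-- fixing all of them relabels every coordinate, i.e. acts on words by a coordinatewise
-- permutation Π that preserves the complement of the image and hence the image itself;
-- the induced permutation of Fin (a′b) fixes the original base, so it is trivial, hence
-- so is Π and so is the permutation. Conversely a base of size m separates points, so
-- ab ≤ b^m, while the hypothesis on ⌈log_b (b^κ − a′b)⌉ says exactly b^(κ−1) < ab.
module Submission where

open import Defs
open import Data.Empty using (⊥-elim)
open import Data.Fin using (Fin; zero; suc; _≟_; cast; combine; toℕ; inject≤)
open import Data.Fin.Properties using (any?; cast-involutive; combine-injective; injective⇒≤; toℕ-injective; toℕ-fromℕ<; toℕ-inject≤; toℕ<n)
open import Data.Fin.Permutation using (Permutation′; _⟨$⟩ʳ_; _⟨$⟩ˡ_; permutation; inverseˡ; inverseʳ)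
import Data.Fin.Permutation as Perm
open import Data.List using (List; []; _∷_; [_]; length; filter; map; _++_; allFin; cartesianProductWith)
import Data.List as List
open import Data.List.Properties using (filter-++; filter-all; filter-none; filter-≐; length-++; length-map; length-tabulate)
open import Data.List.Membership.Propositional using (_∈_)
open import Data.List.Membership.Propositional.Properties using (∈-filter⁺; ∈-filter⁻; ∈-map⁺; ∈-map⁻; ∈-allFin; ∈-lookup; ∈-cartesianProductWith⁺)
open import Data.List.Membership.Propositional.Properties.WithK using (unique∧set⇒bag)
open import Data.List.Relation.Binary.BagAndSetEquality using (∼bag⇒↭)
open import Data.List.Relation.Binary.Permutation.Propositional using (_↭_)
open import Data.List.Relation.Binary.Permutation.Propositional.Properties using (filter-↭; ↭-length)
open import Data.List.Relation.Unary.Any using (here; index)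
open import Data.List.Relation.Unary.Any.Properties using (lookup-index)
import Data.List.Relation.Unary.All as All
open import Data.List.Relation.Unary.AllPairs using ([]; _∷_)
open import Data.List.Relation.Unary.Unique.Propositional using (Unique)
import Data.List.Relation.Unary.Unique.Propositional.Properties as Unique
open import Data.Nat using (ℕ; zero; suc; _+_; _*_; _^_; _∸_; _≤_; _<_; s≤s; z≤n; >-nonZero)
open import Data.Nat.DivMod using (_mod_; _%_; m≤n⇒m%n≡m)
open import Data.Nat.Properties using (+-suc; +-identityʳ; *-identityˡ; *-comm; *-distribʳ-+; *-distribʳ-∸; *-cancelʳ-<; *-mono-≤; ^-monoʳ-≤; m<n⇒0<n∸m; m+n∸m≡n; <⇒≱; ≤-trans; <-≤-trans; ≤-<-trans; ≤-pred; n<1+n)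
open import Data.Product using (Σ; ∃; _,_; proj₁; proj₂)
open import Data.Vec using (Vec; []; _∷_; lookup; tabulate)
open import Data.Vec.Properties using (∷-injective; ≡-dec; lookup∘tabulate; tabulate∘lookup; tabulate-cong)
open import Function using (_∘_; id; Injective)
open import Function.Bundles using (_⇔_; _↔_; mk⇔; mk↔ₛ′; Equivalence; Inverse)
open import Function.Properties.Inverse using (↔-sym)
open import Level using (0ℓ)
open import Relation.Nullary using (¬_; Dec; yes; no; contradiction)
open import Relation.Unary using (Pred; Decidable)
open import Relation.Unary.Properties using (∁?)
open import Relation.Binary.PropositionalEquality using (_≡_; refl; sym; trans; cong; cong₂; subst)
open Relation.Binary.PropositionalEquality.≡-Reasoning
open Inverse using (to; from; strictlyInverseˡ; strictlyInverseʳ)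

module _ {A : Set} {P : Pred A 0ℓ} (P? : Decidable P) where

  length-filter-++ : ∀ xs ys →
    length (filter P? (xs ++ ys)) ≡ length (filter P? xs) + length (filter P? ys)
  length-filter-++ xs ys = trans (cong length (filter-++ P? xs ys)) (length-++ (filter P? xs))

  length-filter+length-filter-∁ : ∀ xs →
    length (filter P? xs) + length (filter (∁? P?) xs) ≡ length xs
  length-filter+length-filter-∁ [] = refl
  length-filter+length-filter-∁ (x ∷ xs) with P? x
  ... | yes _ = cong suc (length-filter+length-filter-∁ xs)
  ... | no _  = trans (+-suc _ _) (cong suc (length-filter+length-filter-∁ xs))

  length-filter-↭ : ∀ {xs ys} → xs ↭ ys → length (filter P? xs) ≡ length (filter P? ys)
  length-filter-↭ xs↭ys = ↭-length (filter-↭ P? xs↭ys)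

  filter-nonempty⇒∃ : ∀ xs → 0 < length (filter P? xs) → ∃ P
  filter-nonempty⇒∃ (x ∷ xs) nonempty with P? x
  ... | yes px = x , px
  ... | no _   = filter-nonempty⇒∃ xs nonempty

length-filter-map : ∀ {A B : Set} {P : Pred A 0ℓ} (P? : Decidable P) (f : B → A) xs →
  length (filter P? (map f xs)) ≡ length (filter (P? ∘ f) xs)
length-filter-map P? f [] = refl
length-filter-map P? f (x ∷ xs) with P? (f x)
... | yes _ = cong suc (length-filter-map P? f xs)
... | no _  = length-filter-map P? f xs

unique-⇔⇒↭ : ∀ {A : Set} {xs ys : List A} → Unique xs → Unique ys →
  (∀ {z} → z ∈ xs ⇔ z ∈ ys) → xs ↭ ys
unique-⇔⇒↭ xs! ys! xs⇔ys = ∼bag⇒↭ (unique∧set⇒bag xs! ys! xs⇔ys)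

module _ {A : Set} {n} {f : Fin n → A} {ys : List A}
  (f-inj : Injective _≡_ _≡_ f) (ys! : Unique ys) (ys⇔image : ∀ {z} → z ∈ ys ⇔ ∃ λ x → f x ≡ z) where

  map-allFin-↭ : map f (allFin n) ↭ ys
  map-allFin-↭ = unique-⇔⇒↭ (Unique.map⁺ f-inj (Unique.allFin⁺ n)) ys! (mk⇔ image⊆ys ys⊆image)
    where
    image⊆ys : ∀ {z} → z ∈ map f (allFin n) → z ∈ ys
    image⊆ys z∈ with ∈-map⁻ f z∈
    ... | x , _ , refl = Equivalence.from ys⇔image (x , refl)
    ys⊆image : ∀ {z} → z ∈ ys → z ∈ map f (allFin n)
    ys⊆image z∈ with Equivalence.to ys⇔image z∈
    ... | x , refl = ∈-map⁺ f (∈-allFin x)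

  length-image : length ys ≡ n
  length-image = trans (sym (↭-length map-allFin-↭)) (trans (length-map f (allFin n)) (length-tabulate id))

  length-filter-image : ∀ {P : Pred A 0ℓ} (P? : Decidable P) →
    length (filter (P? ∘ f) (allFin n)) ≡ length (filter P? ys)
  length-filter-image P? = trans (sym (length-filter-map P? f (allFin n))) (length-filter-↭ P? map-allFin-↭)

module _ {A : Set} {P Q : Pred A 0ℓ} (P? : Decidable P) (Q? : Decidable Q) where

  length-filter-split : ∀ xs →
    length (filter P? xs) ≡ length (filter P? (filter Q? xs)) + length (filter P? (filter (∁? Q?) xs))
  length-filter-split [] = refl
  length-filter-split (x ∷ xs) with Q? x
  ... | yes _ with P? x
  ...   | yes _ = cong suc (length-filter-split xs)
  ...   | no _  = length-filter-split xs
  length-filter-split (x ∷ xs) | no _ with P? x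
  ...   | yes _ = trans (cong suc (length-filter-split xs)) (sym (+-suc _ _))
  ...   | no _  = length-filter-split xs

lookup-injective : ∀ {A : Set} {xs : List A} → Unique xs → Injective _≡_ _≡_ (List.lookup xs)
lookup-injective {xs = x ∷ xs} (x∉xs ∷ xs!) {zero}  {zero}  _ = refl
lookup-injective {xs = x ∷ xs} (x∉xs ∷ xs!) {zero}  {suc j} eq = ⊥-elim (All.lookup x∉xs (∈-lookup j) eq)
lookup-injective {xs = x ∷ xs} (x∉xs ∷ xs!) {suc i} {zero}  eq = ⊥-elim (All.lookup x∉xs (∈-lookup i) (sym eq))
lookup-injective {xs = x ∷ xs} (x∉xs ∷ xs!) {suc i} {suc j} eq = cong suc (lookup-injective xs! eq)

module Enumeration {A : Set} {xs : List A} (xs! : Unique xs) {n} (len : length xs ≡ n) where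

  enumerate : Fin n → A
  enumerate i = List.lookup xs (cast (sym len) i)

  enumerate-injective : Injective _≡_ _≡_ enumerate
  enumerate-injective {i} {j} eq = begin
    i                               ≡⟨ sym (cast-involutive len (sym len) i) ⟩
    cast len (cast (sym len) i)     ≡⟨ cong (cast len) (lookup-injective xs! eq) ⟩
    cast len (cast (sym len) j)     ≡⟨ cast-involutive len (sym len) j ⟩
    j                               ∎

  ∈⇔enumerate : ∀ {z} → z ∈ xs ⇔ ∃ λ i → enumerate i ≡ z
  ∈⇔enumerate = mk⇔ (λ z∈xs → cast len (index z∈xs) , enumerate-index z∈xs)
    λ { (i , refl) → ∈-lookup (cast (sym len) i) }
    where
    enumerate-index : ∀ {z} (z∈xs : z ∈ xs) → enumerate (cast len (index z∈xs)) ≡ z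
    enumerate-index {z} z∈xs = begin
      List.lookup xs (cast (sym len) (cast len (index z∈xs)))
        ≡⟨ cong (List.lookup xs) (cast-involutive (sym len) len _) ⟩
      List.lookup xs (index z∈xs)
        ≡⟨ sym (lookup-index z∈xs) ⟩
      z ∎

-- Words

allVec : ∀ b k → List (Vec (Fin b) k)
allVec b zero    = [ [] ]
allVec b (suc k) = cartesianProductWith _∷_ (allFin b) (allVec b k)

allVec-unique : ∀ b k → Unique (allVec b k)
allVec-unique b zero    = All.[] ∷ []
allVec-unique b (suc k) =
  Unique.cartesianProductWith⁺ _∷_ ∷-injective (Unique.allFin⁺ b) (allVec-unique b k)

∈-allVec : ∀ {b k} (w : Vec (Fin b) k) → w ∈ allVec b k
∈-allVec []      = here refl
∈-allVec (x ∷ w) = ∈-cartesianProductWith⁺ _∷_ (∈-allFin x) (∈-allVec w)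

length-cartesianProductWith : ∀ {A B C : Set} (f : A → B → C) xs ys →
  length (cartesianProductWith f xs ys) ≡ length xs * length ys
length-cartesianProductWith f []       ys = refl
length-cartesianProductWith f (x ∷ xs) ys = begin
  length (map (f x) ys ++ cartesianProductWith f xs ys)
    ≡⟨ length-++ (map (f x) ys) ⟩
  length (map (f x) ys) + length (cartesianProductWith f xs ys)
    ≡⟨ cong₂ _+_ (length-map (f x) ys) (length-cartesianProductWith f xs ys) ⟩
  length ys + length xs * length ys ∎

length-allVec : ∀ b k → length (allVec b k) ≡ b ^ k
length-allVec b zero    = refl
length-allVec b (suc k) = begin
  length (allVec b (suc k))              ≡⟨ length-cartesianProductWith _∷_ (allFin b) (allVec b k) ⟩
  length (allFin b) * length (allVec b k) ≡⟨ cong₂ _*_ (length-tabulate {n = b} id) (length-allVec b k) ⟩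
  b * b ^ k                              ∎

length-filter-≟-allFin : ∀ n (c : Fin n) → length (filter (_≟ c) (allFin n)) ≡ 1
length-filter-≟-allFin n c =
  ↭-length (unique-⇔⇒↭ (Unique.filter⁺ (_≟ c) (Unique.allFin⁺ n)) [c]-unique (mk⇔ ∈⇒≡ ≡⇒∈))
  where
  [c]-unique : Unique [ c ]
  [c]-unique = All.[] ∷ []
  ∈⇒≡ : ∀ {x} → x ∈ filter (_≟ c) (allFin n) → x ∈ [ c ]
  ∈⇒≡ x∈ = here (proj₂ (∈-filter⁻ (_≟ c) {xs = allFin n} x∈))
  ≡⇒∈ : ∀ {x} → x ∈ [ c ] → x ∈ filter (_≟ c) (allFin n)
  ≡⇒∈ (here refl) = ∈-filter⁺ (_≟ c) (∈-allFin c) refl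

length-filter-const : ∀ {A B : Set} {P : Pred A 0ℓ} (P? : Decidable P) (x : A) (ys : List B) →
  length (filter (λ _ → P? x) ys) ≡ length (filter P? [ x ]) * length ys
length-filter-const P? x ys with P? x
... | yes px = trans (cong length (filter-all _ (All.universal (λ _ → px) ys))) (sym (+-identityʳ _))
... | no ¬px = cong length (filter-none _ (All.universal (λ _ → ¬px) ys))

length-filter-lookup-zero : ∀ {b k} (c : Fin b) xs (ys : List (Vec (Fin b) k)) →
  length (filter (λ w → lookup w zero ≟ c) (cartesianProductWith _∷_ xs ys))
    ≡ length (filter (_≟ c) xs) * length ys
length-filter-lookup-zero c []       ys = refl
length-filter-lookup-zero c (x ∷ xs) ys = begin
  length (filter P? (map (x ∷_) ys ++ rest))
    ≡⟨ length-filter-++ P? (map (x ∷_) ys) rest ⟩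
  length (filter P? (map (x ∷_) ys)) + length (filter P? rest)
    ≡⟨ cong₂ _+_ (length-filter-map P? (x ∷_) ys) (length-filter-lookup-zero c xs ys) ⟩
  length (filter (λ _ → x ≟ c) ys) + length (filter (_≟ c) xs) * length ys
    ≡⟨ cong (_+ _) (length-filter-const (_≟ c) x ys) ⟩
  length (filter (_≟ c) [ x ]) * length ys + length (filter (_≟ c) xs) * length ys
    ≡⟨ sym (*-distribʳ-+ (length ys) (length (filter (_≟ c) [ x ])) _) ⟩
  (length (filter (_≟ c) [ x ]) + length (filter (_≟ c) xs)) * length ys
    ≡⟨ cong (_* length ys) (sym (length-filter-++ (_≟ c) [ x ] xs)) ⟩
  length (filter (_≟ c) (x ∷ xs)) * length ys ∎
  where
  P? = λ w → lookup w zero ≟ c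
  rest = cartesianProductWith _∷_ xs ys

length-filter-lookup-suc : ∀ {b k} (i : Fin k) (c : Fin b) xs (ys : List (Vec (Fin b) k)) →
  length (filter (λ w → lookup w (suc i) ≟ c) (cartesianProductWith _∷_ xs ys))
    ≡ length xs * length (filter (λ w → lookup w i ≟ c) ys)
length-filter-lookup-suc i c []       ys = refl
length-filter-lookup-suc i c (x ∷ xs) ys =
  trans (length-filter-++ P? (map (x ∷_) ys) _)
        (cong₂ _+_ (length-filter-map P? (x ∷_) ys) (length-filter-lookup-suc i c xs ys))
  where P? = λ w → lookup w (suc i) ≟ c

length-filter-lookup-allVec : ∀ b k (i : Fin (suc k)) (c : Fin b) →
  length (filter (λ w → lookup w i ≟ c) (allVec b (suc k))) ≡ b ^ k
length-filter-lookup-allVec b k zero c = begin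
  length (filter (λ w → lookup w zero ≟ c) (allVec b (suc k)))
    ≡⟨ length-filter-lookup-zero c (allFin b) (allVec b k) ⟩
  length (filter (_≟ c) (allFin b)) * length (allVec b k)
    ≡⟨ cong₂ _*_ (length-filter-≟-allFin b c) (length-allVec b k) ⟩
  1 * b ^ k
    ≡⟨ *-identityˡ (b ^ k) ⟩
  b ^ k ∎
length-filter-lookup-allVec b (suc k) (suc i) c = begin
  length (filter (λ w → lookup w (suc i) ≟ c) (allVec b (suc (suc k))))
    ≡⟨ length-filter-lookup-suc i c (allFin b) (allVec b (suc k)) ⟩
  length (allFin b) * length (filter (λ w → lookup w i ≟ c) (allVec b (suc k)))
    ≡⟨ cong₂ _*_ (length-tabulate {n = b} id) (length-filter-lookup-allVec b k i c) ⟩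
  b * b ^ k ∎

lookup-extensionality : ∀ {A : Set} {k} {u v : Vec A k} → (∀ i → lookup u i ≡ lookup v i) → u ≡ v
lookup-extensionality {u = u} {v} u≗v = begin
  u                    ≡⟨ sym (tabulate∘lookup u) ⟩
  tabulate (lookup u)  ≡⟨ tabulate-cong u≗v ⟩
  tabulate (lookup v)  ≡⟨ tabulate∘lookup v ⟩
  v                    ∎

onCoordinates : ∀ {A : Set} {k} → (Fin k → A → A) → Vec A k → Vec A k
onCoordinates g w = tabulate λ i → g i (lookup w i)

lookup-onCoordinates : ∀ {A : Set} {k} (g : Fin k → A → A) w i →
  lookup (onCoordinates g w) i ≡ g i (lookup w i)
lookup-onCoordinates g w = lookup∘tabulate (λ i → g i (lookup w i))

onCoordinates-inverse : ∀ {A : Set} {k} {g h : Fin k → A → A} → (∀ i x → h i (g i x) ≡ x) →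
  ∀ w → onCoordinates h (onCoordinates g w) ≡ w
onCoordinates-inverse {g = g} {h} hg≡id w = lookup-extensionality λ i → begin
  lookup (onCoordinates h (onCoordinates g w)) i  ≡⟨ lookup-onCoordinates h (onCoordinates g w) i ⟩
  h i (lookup (onCoordinates g w) i)              ≡⟨ cong (h i) (lookup-onCoordinates g w i) ⟩
  h i (g i (lookup w i))                          ≡⟨ hg≡id i (lookup w i) ⟩
  lookup w i                                      ∎

coordinatewise : ∀ {b k} → (Fin k → Permutation′ b) → Vec (Fin b) k ↔ Vec (Fin b) k
coordinatewise π = mk↔ₛ′ (onCoordinates λ i → π i ⟨$⟩ʳ_) (onCoordinates λ i → π i ⟨$⟩ˡ_)
  (onCoordinates-inverse {g = λ i → π i ⟨$⟩ˡ_} {λ i → π i ⟨$⟩ʳ_} λ i _ → inverseʳ (π i))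
  (onCoordinates-inverse {g = λ i → π i ⟨$⟩ʳ_} {λ i → π i ⟨$⟩ˡ_} λ i _ → inverseˡ (π i))

-- Restricting a permutation to an image

module _ {W : Set} {N : ℕ} (f : Fin N → W) where

  MapsImageInto : (W → W) → Set
  MapsImageInto h = ∀ x → ∃ λ x′ → f x′ ≡ h (f x)

  restrict : Injective _≡_ _≡_ f → (Π : W ↔ W) → MapsImageInto (to Π) → MapsImageInto (from Π) →
    Σ (Permutation′ N) λ τ → ∀ x → f (τ ⟨$⟩ʳ x) ≡ to Π (f x)
  restrict f-inj Π into into⁻¹ = permutation τ τ⁻¹ τ∘τ⁻¹ τ⁻¹∘τ , λ x → proj₂ (into x)
    where
    τ τ⁻¹ : Fin N → Fin N
    τ x = proj₁ (into x)
    τ⁻¹ x = proj₁ (into⁻¹ x)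
    τ∘τ⁻¹ : ∀ x → τ (τ⁻¹ x) ≡ x
    τ∘τ⁻¹ x = f-inj (begin
      f (τ (τ⁻¹ x))        ≡⟨ proj₂ (into (τ⁻¹ x)) ⟩
      to Π (f (τ⁻¹ x))     ≡⟨ cong (to Π) (proj₂ (into⁻¹ x)) ⟩
      to Π (from Π (f x))  ≡⟨ strictlyInverseˡ Π (f x) ⟩
      f x                  ∎)
    τ⁻¹∘τ : ∀ x → τ⁻¹ (τ x) ≡ x
    τ⁻¹∘τ x = f-inj (begin
      f (τ⁻¹ (τ x))        ≡⟨ proj₂ (into⁻¹ (τ x)) ⟩
      from Π (f (τ x))     ≡⟨ cong (from Π) (proj₂ (into x)) ⟩
      from Π (to Π (f x))  ≡⟨ strictlyInverseʳ Π (f x) ⟩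
      f x                  ∎)

  intertwines⇒mapsImageInto-from : ∀ (σ : Permutation′ N) (Π : W ↔ W) →
    (∀ x → f (σ ⟨$⟩ʳ x) ≡ to Π (f x)) → MapsImageInto (from Π)
  intertwines⇒mapsImageInto-from σ Π fσ≡Πf x = σ ⟨$⟩ˡ x , (begin
    f (σ ⟨$⟩ˡ x)                 ≡⟨ sym (strictlyInverseʳ Π _) ⟩
    from Π (to Π (f (σ ⟨$⟩ˡ x)))  ≡⟨ cong (from Π) (sym (fσ≡Πf (σ ⟨$⟩ˡ x))) ⟩
    from Π (f (σ ⟨$⟩ʳ (σ ⟨$⟩ˡ x))) ≡⟨ cong (from Π ∘ f) (inverseʳ σ) ⟩
    from Π (f x)                  ∎)

module _ {W : Set} {N n : ℕ} {f : Fin N → W} {e : Fin n → W}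
  (image? : ∀ w → Dec (∃ λ x → f x ≡ w))
  (e-covers : ∀ w → ¬ (∃ λ x → f x ≡ w) → ∃ λ y → e y ≡ w)
  (e-avoids : ∀ y → ¬ (∃ λ x → f x ≡ e y)) where

  complement-mapsImageInto : (Π : W ↔ W) → MapsImageInto e (from Π) → MapsImageInto f (to Π)
  complement-mapsImageInto Π e-into x with image? (to Π (f x))
  ... | yes in-image = in-image
  ... | no ∉image = ⊥-elim (e-avoids y′ (x , sym (begin
    e y′                 ≡⟨ proj₂ (e-into y) ⟩
    from Π (e y)         ≡⟨ cong (from Π) (proj₂ (e-covers _ ∉image)) ⟩
    from Π (to Π (f x))  ≡⟨ strictlyInverseʳ Π (f x) ⟩
    f x                  ∎)))
    where
    y = proj₁ (e-covers _ ∉image)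
    y′ = proj₁ (e-into y)

-- Partitions, relabellings and bases

⟨$⟩ʳ-injective : ∀ {n} (π : Permutation′ n) → Injective _≡_ _≡_ (π ⟨$⟩ʳ_)
⟨$⟩ʳ-injective π {x} {y} πx≡πy = trans (sym (inverseˡ π)) (trans (cong (π ⟨$⟩ˡ_) πx≡πy) (inverseˡ π))

transpose-moves : ∀ {n} (i j : Fin n) → Perm.transpose i j ⟨$⟩ʳ i ≡ j
transpose-moves i j with i ≟ i
... | yes _  = refl
... | no i≢i = contradiction refl i≢i

transpose-preserves : ∀ {n} {B : Set} (g : Fin n → B) {i j : Fin n} → g i ≡ g j →
  ∀ k → g (Perm.transpose i j ⟨$⟩ʳ k) ≡ g k
transpose-preserves g {i} {j} gi≡gj k with k ≟ i
... | yes refl = sym gi≡gj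
... | no _ with k ≟ j
...   | yes refl = gi≡gj
...   | no _     = refl

module _ {a b} (P : Part a b) where

  Relabels : Permutation′ (a * b) → Permutation′ b → Set
  Relabels σ π = ∀ x → lab P (σ ⟨$⟩ʳ x) ≡ π ⟨$⟩ʳ lab P x

  relabels⇒fixes : ∀ {σ π} → Relabels σ π → Fixes σ P
  relabels⇒fixes {σ} {π} σ∼π x y = mk⇔
    (λ same → trans (σ∼π x) (trans (cong (π ⟨$⟩ʳ_) same) (sym (σ∼π y))))
    (λ same → ⟨$⟩ʳ-injective π (trans (sym (σ∼π x)) (trans same (σ∼π y))))

  transpose-fixes : ∀ {x y} → lab P x ≡ lab P y → Fixes (Perm.transpose x y) P
  transpose-fixes {x} {y} same = relabels⇒fixes {Perm.transpose x y} {Perm.id} (transpose-preserves (lab P) same)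

  module _ (a>0 : 0 < a) where

    lab-surjective : ∀ c → ∃ λ x → lab P x ≡ c
    lab-surjective c = filter-nonempty⇒∃ (λ x → lab P x ≟ c) (allFin (a * b)) (subst (0 <_) (sym (size P c)) a>0)

    onLabels : (Fin (a * b) → Fin (a * b)) → Fin b → Fin b
    onLabels s c = lab P (s (proj₁ (lab-surjective c)))

    PreservesParts : (Fin (a * b) → Fin (a * b)) → Set
    PreservesParts s = ∀ {x y} → lab P x ≡ lab P y → lab P (s x) ≡ lab P (s y)

    onLabels-lab : ∀ {s} → PreservesParts s → ∀ x → lab P (s x) ≡ onLabels s (lab P x)
    onLabels-lab s-pres x = s-pres (sym (proj₂ (lab-surjective (lab P x))))

    onLabels-inverse : ∀ {s t} → PreservesParts t → (∀ x → t (s x) ≡ x) →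
      ∀ c → onLabels t (onLabels s c) ≡ c
    onLabels-inverse {s} {t} t-pres ts≡id c = begin
      onLabels t (lab P (s x))  ≡⟨ sym (onLabels-lab t-pres (s x)) ⟩
      lab P (t (s x))           ≡⟨ cong (lab P) (ts≡id x) ⟩
      lab P x                   ≡⟨ proj₂ (lab-surjective c) ⟩
      c                         ∎
      where x = proj₁ (lab-surjective c)

    fixes⇒relabels : ∀ {σ} → Fixes σ P → ∃ (Relabels σ)
    fixes⇒relabels {σ} σ-fixes = π , onLabels-lab σ-pres
      where
      σ-pres : PreservesParts (σ ⟨$⟩ʳ_)
      σ-pres {x} {y} = Equivalence.to (σ-fixes x y)
      σ⁻¹-pres : PreservesParts (σ ⟨$⟩ˡ_)
      σ⁻¹-pres {x} {y} same = Equivalence.from (σ-fixes (σ ⟨$⟩ˡ x) (σ ⟨$⟩ˡ y))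
        (trans (cong (lab P) (inverseʳ σ)) (trans same (cong (lab P) (sym (inverseʳ σ)))))
      π : Permutation′ b
      π = permutation (onLabels (σ ⟨$⟩ʳ_)) (onLabels (σ ⟨$⟩ˡ_))
        (onLabels-inverse σ-pres (λ _ → inverseʳ σ)) (onLabels-inverse σ⁻¹-pres (λ _ → inverseˡ σ))

    relabels-by-identity : ∀ {σ π} → Relabels σ π → (∀ x → σ ⟨$⟩ʳ x ≡ x) → ∀ c → π ⟨$⟩ʳ c ≡ c
    relabels-by-identity {σ} {π} σ∼π σ≡id c = begin
      π ⟨$⟩ʳ c          ≡⟨ cong (π ⟨$⟩ʳ_) (sym (proj₂ (lab-surjective c))) ⟩
      π ⟨$⟩ʳ lab P x    ≡⟨ sym (σ∼π x) ⟩
      lab P (σ ⟨$⟩ʳ x)  ≡⟨ cong (lab P) (σ≡id x) ⟩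
      lab P x           ≡⟨ proj₂ (lab-surjective c) ⟩
      c                 ∎
      where x = proj₁ (lab-surjective c)

IsBaseFamily : ∀ {a b k} → (Fin k → Part a b) → Set
IsBaseFamily {a} {b} Q = ∀ (σ : Permutation′ (a * b)) → (∀ i → Fixes σ (Q i)) → ∀ x → σ ⟨$⟩ʳ x ≡ x

signature : ∀ {a b k} → (Fin k → Part a b) → Fin (a * b) → Vec (Fin b) k
signature Q x = tabulate (λ i → lab (Q i) x)

lookup-signature : ∀ {a b k} (Q : Fin k → Part a b) x i → lookup (signature Q x) i ≡ lab (Q i) x
lookup-signature Q x i = lookup∘tabulate (λ i → lab (Q i) x) i

signature-injective : ∀ {a b k} {Q : Fin k → Part a b} → IsBaseFamily Q → Injective _≡_ _≡_ (signature Q)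
signature-injective {Q = Q} base {x} {y} sx≡sy = begin
  x                               ≡⟨ sym (base (Perm.transpose x y) swap-fixes x) ⟩
  Perm.transpose x y ⟨$⟩ʳ x       ≡⟨ transpose-moves x y ⟩
  y                               ∎
  where
  same-part : ∀ i → lab (Q i) x ≡ lab (Q i) y
  same-part i = trans (sym (lookup-signature Q x i))
    (trans (cong (λ w → lookup w i) sx≡sy) (lookup-signature Q y i))
  swap-fixes : ∀ i → Fixes (Perm.transpose x y) (Q i)
  swap-fixes i = transpose-fixes (Q i) (same-part i)

encode : ∀ {b k} → Vec (Fin b) k → Fin (b ^ k)
encode []      = zero
encode (x ∷ w) = combine x (encode w)

encode-injective : ∀ {b k} → Injective _≡_ _≡_ (encode {b} {k})
encode-injective {x = []}    {[]}    _ = refl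
encode-injective {x = x ∷ u} {y ∷ v} eq with combine-injective x (encode u) y (encode v) eq
... | refl , eu≡ev = cong (x ∷_) (encode-injective eu≡ev)

isBaseFamily⇒≤ : ∀ {a b k} {Q : Fin k → Part a b} → IsBaseFamily Q → a * b ≤ b ^ k
isBaseFamily⇒≤ {Q = Q} base = injective⇒≤ (signature-injective {Q = Q} base ∘ encode-injective)

isBase⇒isBaseFamily : ∀ {a b} {S : List (Part a b)} → IsBase a b S → IsBaseFamily (List.lookup S)
isBase⇒isBaseFamily {a} {S = S} base σ fixes = base σ (All.tabulate λ P∈S →
  subst (Fixes {a} σ) (sym (lookup-index P∈S)) (fixes (index P∈S)))

isBaseFamily⇒isBase : ∀ {a b k} {Q : Fin k → Part a b} → IsBaseFamily Q → IsBase a b (map Q (allFin k))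
isBaseFamily⇒isBase base σ fixes = base σ (λ i → All.lookup fixes (∈-map⁺ _ (∈-allFin i)))

isBaseFamily-reindex : ∀ {a b k l} {Q : Fin k → Part a b} → IsBaseFamily Q →
  (g : Fin l → Fin k) → (∀ i → ∃ λ j → g j ≡ i) → IsBaseFamily (Q ∘ g)
isBaseFamily-reindex {a} {Q = Q} base g g-onto σ fixes = base σ λ i →
  let j , gj≡i = g-onto i in subst (Fixes {a} σ ∘ Q) gj≡i (fixes j)

hasBaseOfSize⇒≤ : ∀ {a b m} → HasBaseOfSize a b m → a * b ≤ b ^ m
hasBaseOfSize⇒≤ (S , refl , base) = isBaseFamily⇒≤ {Q = List.lookup S} (isBase⇒isBaseFamily base)

-- Pad a base to k members by cycling through it; repeated members do not change the stabiliser.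
hasBaseOfSize⇒family : ∀ {a b m k} → 1 < a * b → m ≤ k → HasBaseOfSize a b m →
  Σ (Fin k → Part a b) IsBaseFamily
hasBaseOfSize⇒family 1<ab _ base@([] , refl , _) = ⊥-elim (<⇒≱ 1<ab (hasBaseOfSize⇒≤ base))
hasBaseOfSize⇒family {k = k} _ m≤k (S@(_ ∷ S′) , refl , base) =
  List.lookup S ∘ wrap , isBaseFamily-reindex {Q = List.lookup S} (isBase⇒isBaseFamily base) wrap wrap-onto
  where
  m = length S′
  wrap : Fin k → Fin (suc m)
  wrap i = toℕ i mod suc m
  wrap-onto : ∀ j → ∃ λ i → wrap i ≡ j
  wrap-onto j = inject≤ j m≤k , toℕ-injective (begin
    toℕ (toℕ (inject≤ j m≤k) mod suc m)  ≡⟨ toℕ-fromℕ< _ ⟩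
    toℕ (inject≤ j m≤k) % suc m          ≡⟨ cong (_% suc m) (toℕ-inject≤ j m≤k) ⟩
    toℕ j % suc m                        ≡⟨ m≤n⇒m%n≡m (≤-pred (toℕ<n j)) ⟩
    toℕ j                                ∎)

isBaseFamily⇒hasBaseOfSize : ∀ {a b k} {Q : Fin k → Part a b} → IsBaseFamily Q → HasBaseOfSize a b k
isBaseFamily⇒hasBaseOfSize {k = k} {Q} base =
  map Q (allFin k) , trans (length-map Q (allFin k)) (length-tabulate id) , isBaseFamily⇒isBase {Q = Q} base

-- The complementary partitions

module Complement {a′ b k : ℕ} (Q : Fin (suc k) → Part a′ b) (Q-base : IsBaseFamily Q)
  (a′>0 : 0 < a′) (a′b<b^K : a′ * b < b ^ suc k) where

  Word : Set
  Word = Vec (Fin b) (suc k)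

  a : ℕ
  a = b ^ k ∸ a′

  a>0 : 0 < a
  a>0 = m<n⇒0<n∸m (*-cancelʳ-< b a′ (b ^ k) (subst (a′ * b <_) (*-comm b (b ^ k)) a′b<b^K))

  b^K∸a′b≡ab : b ^ suc k ∸ a′ * b ≡ a * b
  b^K∸a′b≡ab = trans (cong (_∸ a′ * b) (*-comm b (b ^ k))) (sym (*-distribʳ-∸ b (b ^ k) a′))

  f : Fin (a′ * b) → Word
  f = signature Q

  f-injective : ∀ {x y} → f x ≡ f y → x ≡ y
  f-injective = signature-injective {Q = Q} Q-base

  InImage : Word → Set
  InImage w = ∃ λ x → f x ≡ w

  inImage? : Decidable InImage
  inImage? w = any? λ x → ≡-dec _≟_ (f x) w

  image complement : List Word
  image      = filter inImage? (allVec b (suc k))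
  complement = filter (∁? inImage?) (allVec b (suc k))

  ∈-image⇔ : ∀ {w} → w ∈ image ⇔ InImage w
  ∈-image⇔ = mk⇔ (proj₂ ∘ ∈-filter⁻ inImage? {xs = allVec b (suc k)}) (∈-filter⁺ inImage? (∈-allVec _))

  ∈-complement⇔ : ∀ {w} → w ∈ complement ⇔ (¬ InImage w)
  ∈-complement⇔ = mk⇔ (proj₂ ∘ ∈-filter⁻ (∁? inImage?) {xs = allVec b (suc k)})
    (∈-filter⁺ (∁? inImage?) (∈-allVec _))

  image-unique : Unique image
  image-unique = Unique.filter⁺ inImage? (allVec-unique b (suc k))

  complement-unique : Unique complement
  complement-unique = Unique.filter⁺ (∁? inImage?) (allVec-unique b (suc k))

  length-complement : length complement ≡ a * b
  length-complement = begin
    length complement                               ≡⟨ sym (m+n∸m≡n (length image) _) ⟩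
    length image + length complement ∸ length image
      ≡⟨ cong₂ _∸_ (length-filter+length-filter-∁ inImage? (allVec b (suc k))) length-I ⟩
    length (allVec b (suc k)) ∸ a′ * b              ≡⟨ cong (_∸ a′ * b) (length-allVec b (suc k)) ⟩
    b ^ suc k ∸ a′ * b                              ≡⟨ b^K∸a′b≡ab ⟩
    a * b                                           ∎
    where
    length-I : length image ≡ a′ * b
    length-I = length-image f-injective image-unique ∈-image⇔

  open Enumeration complement-unique length-complement
    renaming (enumerate to e; enumerate-injective to e-injective; ∈⇔enumerate to ∈-complement⇔e)

  e-avoids : ∀ y → ¬ InImage (e y)
  e-avoids y = Equivalence.to ∈-complement⇔ (Equivalence.from ∈-complement⇔e (y , refl))

  e-covers : ∀ w → ¬ InImage w → ∃ λ y → e y ≡ w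
  e-covers w ∉image = Equivalence.to ∈-complement⇔e (Equivalence.from ∈-complement⇔ ∉image)

  length-filter-e : ∀ {P : Word → Set} (P? : Decidable P) →
    length (filter (P? ∘ e) (allFin (a * b)))
      ≡ length (filter P? (allVec b (suc k))) ∸ length (filter (P? ∘ f) (allFin (a′ * b)))
  length-filter-e P? = begin
    length (filter (P? ∘ e) (allFin (a * b)))
      ≡⟨ length-filter-image e-injective complement-unique ∈-complement⇔e P? ⟩
    length (filter P? complement)
      ≡⟨ sym (m+n∸m≡n (length (filter P? image)) _) ⟩
    length (filter P? image) + length (filter P? complement) ∸ length (filter P? image)
      ≡⟨ cong₂ _∸_ (sym (length-filter-split P? inImage? (allVec b (suc k))))
                   (sym (length-filter-image f-injective image-unique ∈-image⇔ P?)) ⟩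
    length (filter P? (allVec b (suc k))) ∸ length (filter (P? ∘ f) (allFin (a′ * b))) ∎

  coordinate : Fin (suc k) → Part a b
  coordinate i = record { lab = λ y → lookup (e y) i ; size = size-coordinate }
    where
    same-count : ∀ c → length (filter (λ x → lookup (f x) i ≟ c) (allFin (a′ * b))) ≡ a′
    same-count c = trans
      (cong length (filter-≐ (λ x → lookup (f x) i ≟ c) (λ x → lab (Q i) x ≟ c)
        ((λ {x} → trans (sym (lookup-signature Q x i))) , (λ {x} → trans (lookup-signature Q x i)))
        (allFin (a′ * b))))
      (size (Q i) c)
    size-coordinate : ∀ c → length (filter (λ y → lookup (e y) i ≟ c) (allFin (a * b))) ≡ a
    size-coordinate c = trans (length-filter-e (λ w → lookup w i ≟ c))
      (cong₂ _∸_ (length-filter-lookup-allVec b k i c) (same-count c))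

  module _ (σ : Permutation′ (a * b)) (σ-fixes : ∀ i → Fixes σ (coordinate i)) where

    relabelling : ∀ i → ∃ (Relabels (coordinate i) σ)
    relabelling i = fixes⇒relabels (coordinate i) a>0 {σ} (σ-fixes i)

    π : Fin (suc k) → Permutation′ b
    π i = proj₁ (relabelling i)

    Π : Word ↔ Word
    Π = coordinatewise π

    e∘σ : ∀ y → e (σ ⟨$⟩ʳ y) ≡ to Π (e y)
    e∘σ y = lookup-extensionality λ i →
      trans (proj₂ (relabelling i) y) (sym (lookup-onCoordinates (λ i → π i ⟨$⟩ʳ_) (e y) i))

    f-into : MapsImageInto f (to Π)
    f-into = complement-mapsImageInto inImage? e-covers e-avoids Π
      (intertwines⇒mapsImageInto-from e σ Π e∘σ)

    f-into⁻¹ : MapsImageInto f (from Π)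
    f-into⁻¹ = complement-mapsImageInto inImage? e-covers e-avoids (↔-sym Π)
      (λ y → σ ⟨$⟩ʳ y , e∘σ y)

    restriction : Σ (Permutation′ (a′ * b)) λ τ → ∀ x → f (τ ⟨$⟩ʳ x) ≡ to Π (f x)
    restriction = restrict f f-injective Π f-into f-into⁻¹

    τ : Permutation′ (a′ * b)
    τ = proj₁ restriction

    τ-relabels : ∀ i → Relabels (Q i) τ (π i)
    τ-relabels i x = begin
      lab (Q i) (τ ⟨$⟩ʳ x)             ≡⟨ sym (lookup-signature Q (τ ⟨$⟩ʳ x) i) ⟩
      lookup (f (τ ⟨$⟩ʳ x)) i          ≡⟨ cong (λ w → lookup w i) (proj₂ restriction x) ⟩
      lookup (to Π (f x)) i            ≡⟨ lookup-onCoordinates (λ i → π i ⟨$⟩ʳ_) (f x) i ⟩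
      π i ⟨$⟩ʳ lookup (f x) i          ≡⟨ cong (π i ⟨$⟩ʳ_) (lookup-signature Q x i) ⟩
      π i ⟨$⟩ʳ lab (Q i) x             ∎

    τ≡id : ∀ x → τ ⟨$⟩ʳ x ≡ x
    τ≡id = Q-base τ λ i → relabels⇒fixes (Q i) {τ} {π i} (τ-relabels i)

    π≡id : ∀ i c → π i ⟨$⟩ʳ c ≡ c
    π≡id i = relabels-by-identity (Q i) a′>0 {τ} {π i} (τ-relabels i) τ≡id

    σ≡id : ∀ y → σ ⟨$⟩ʳ y ≡ y
    σ≡id y = e-injective (trans (e∘σ y) (lookup-extensionality λ i →
      trans (lookup-onCoordinates (λ i → π i ⟨$⟩ʳ_) (e y) i) (π≡id i (lookup (e y) i))))

  coordinate-isBaseFamily : IsBaseFamily coordinate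
  coordinate-isBaseFamily = σ≡id

complement-baseSizeIs : ∀ {a′ b k} → 2 ≤ a′ → 0 < b → a′ * b < b ^ suc k → b ^ k < b ^ suc k ∸ a′ * b →
  BaseSizeAtMost a′ b (suc k) → BaseSizeIs (b ^ k ∸ a′) b (suc k)
complement-baseSizeIs {a′} {b} {k} 2≤a′ b>0 a′b<b^K b^k<b^K∸a′b (m , m≤K , a′-base) =
  isBaseFamily⇒hasBaseOfSize {Q = coordinate} coordinate-isBaseFamily , no-smaller-base
  where
  padded = hasBaseOfSize⇒family (*-mono-≤ {2} {a′} {1} {b} 2≤a′ b>0) m≤K a′-base
  open Complement (proj₁ padded) (proj₂ padded) (≤-trans (s≤s z≤n) 2≤a′) a′b<b^K
  no-smaller-base : ∀ m → m < suc k → ¬ HasBaseOfSize a b m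
  no-smaller-base m m<K base = <⇒≱ b^m<ab (hasBaseOfSize⇒≤ base)
    where
    b^m<ab : b ^ m < a * b
    b^m<ab = ≤-<-trans (^-monoʳ-≤ b {{>-nonZero b>0}} (≤-pred m<K))
                       (subst (b ^ k <_) b^K∸a′b≡ab b^k<b^K∸a′b)

lemma5p1 : ∀ (a′ b : ℕ) → 2 ≤ a′ → 2 ≤ b →
    ∀ (κ l : ℕ) → a′ * b < b ^ κ → IsCeilLog b (b ^ κ ∸ a′ * b) l →
    BaseSizeAtMost a′ b κ → κ ≤ l →
    BaseSizeIs (b ^ (κ ∸ 1) ∸ a′) b κ
lemma5p1 a′ b 2≤a′ 2≤b zero l a′b<1 _ _ _ =
  ⊥-elim (<⇒≱ a′b<1 (*-mono-≤ {1} {a′} {1} {b} (≤-trans (s≤s z≤n) 2≤a′) (≤-trans (s≤s z≤n) 2≤b)))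
lemma5p1 a′ b 2≤a′ 2≤b (suc k) l a′b<b^κ (_ , below-l) b[a′,b]≤κ κ≤l =
  complement-baseSizeIs 2≤a′ (≤-trans (s≤s z≤n) 2≤b) a′b<b^κ
    (below-l k (<-≤-trans (n<1+n k) κ≤l)) b[a′,b]≤κ
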